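{- Let $r\ge 3$ and $n_1,\dots,n_r\ge 1$ be integers, let $G$ be the spider graph $S_{n_1,\dots,n_r}$, let $n=n_1+\cdots+n_r+1$, and let $k$ be the number of indices $i$ with $n_i$ odd. If $k=0$ or $k=2$ then $t_2(G)=b_2(G)-1$, and if $k=1$ or $k\ge 3$ then $t_2(G)=b_2(G)$.
   Context: All graphs are finite and connected. The spider graph $S_{n_1,\dots,n_r}$ consists of a central vertex $v^*$ together with $r$ vertex-disjoint paths $P_{n_1},\dots,P_{n_r}$ (the path $P_{n_i}$ having $n_i$ vertices), where $v^*$ is joined by an edge to one endpoint of each path. The 2-burning process: given a graph $G$ and a sequence $s=(s_1,\dots,s_m)$ of vertices of $G$ (sources), at round $0$ all vertices are uncolored; at each round $j\ge1$, (i) if $j\le m$ and $s_j$ is uncolored, $s_j$ is colored blue, and (ii) every uncolored vertex having at least two neighbors that were blue at the end of round $j-1$ is colored blue. $s$ is a 2-burning sequence if eventually all vertices are blue; $\mathrm{len}(s)=m$ and $\mathrm{rd}(s)$ is the first round at the end of which all vertices are blue. $b_2(G)$ is the minimum of $\mathrm{rd}(s)$ over all 2-burning sequences; a 2-burning sequence achieving it is optimal; $t_2(G)$ is the minimum length $\mathrm{len}(s)$ of an optimal 2-burning sequence. -}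

module Defs where

open import Data.Nat using (ℕ; zero; suc; _+_; _≤_; _%_)
open import Data.Fin using (Fin) renaming (zero to fzero; suc to fsuc)
open import Data.List using (List; []; _∷_; length)
open import Data.Product using (Σ; _×_; _,_)
open import Data.Sum using (_⊎_)
open import Data.Empty using (⊥)
open import Relation.Binary.PropositionalEquality using (_≡_)
open import Relation.Nullary using (¬_)

-- Spider graph S_{n_1,...,n_r}.
-- Legs are indexed by i : Fin r, leg i has (n i) vertices leg i 0, ..., leg i (n i - 1);
-- leg i 0 is the endpoint joined to the centre.

data SpiderV (r : ℕ) (n : Fin r → ℕ) : Set where
  centre : SpiderV r n
  leg    : (i : Fin r) → Fin (n i) → SpiderV r n

data SpiderEdge (r : ℕ) (n : Fin r → ℕ) : SpiderV r n → SpiderV r n → Set where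
  centre-leg : (i : Fin r) (j : Fin (n i)) → Data.Fin.toℕ j ≡ 0 →
               SpiderEdge r n centre (leg i j)
  leg-leg    : (i : Fin r) (j j' : Fin (n i)) → Data.Fin.toℕ j' ≡ suc (Data.Fin.toℕ j) →
               SpiderEdge r n (leg i j) (leg i j')

SpiderAdj : (r : ℕ) (n : Fin r → ℕ) → SpiderV r n → SpiderV r n → Set
SpiderAdj r n u v = SpiderEdge r n u v ⊎ SpiderEdge r n v u

-- SourceAt s j v : the (j+1)-st source s_{j+1} exists and equals v.
SourceAt : {V : Set} → List V → ℕ → V → Set
SourceAt []       _       _ = ⊥
SourceAt (x ∷ xs) zero    v = x ≡ v
SourceAt (x ∷ xs) (suc j) v = SourceAt xs j v

-- Blue Adj s j v : v is blue at the end of round j.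
-- Round j+1: keep blue vertices, colour s_{j+1} (if j+1 ≤ len s), and colour every
-- vertex with at least two (distinct) neighbours blue at the end of round j.
Blue : {V : Set} → (V → V → Set) → List V → ℕ → V → Set
Blue Adj s zero    v = ⊥
Blue Adj s (suc j) v =
  Blue Adj s j v
  ⊎ SourceAt s j v
  ⊎ Σ _ (λ u → Σ _ (λ w → ¬ (u ≡ w) × Adj u v × Adj w v
                           × Blue Adj s j u × Blue Adj s j w))

AllBlue : {V : Set} → (V → V → Set) → List V → ℕ → Set
AllBlue {V} Adj s j = (v : V) → Blue Adj s j v

IsRd : {V : Set} → (V → V → Set) → List V → ℕ → Set
IsRd Adj s j = AllBlue Adj s j × ((i : ℕ) → AllBlue Adj s i → j ≤ i)

IsB2 : {V : Set} → (V → V → Set) → ℕ → Set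
IsB2 {V} Adj b =
  Σ (List V) (λ s → IsRd Adj s b)
  × ((s : List V) (j : ℕ) → IsRd Adj s j → b ≤ j)

Optimal : {V : Set} → (V → V → Set) → ℕ → List V → Set
Optimal Adj b s = IsRd Adj s b

IsT2 : {V : Set} → (V → V → Set) → ℕ → ℕ → Set
IsT2 {V} Adj b t =
  Σ (List V) (λ s → Optimal Adj b s × length s ≡ t)
  × ((s : List V) → Optimal Adj b s → t ≤ length s)

countOdd : (r : ℕ) → (Fin r → ℕ) → ℕ
countOdd zero    n = 0
countOdd (suc r) n = n fzero % 2 + countOdd r (λ i → n (fsuc i))

module Submission where

-- Let Q = Σᵢ ⌊nᵢ/2⌋ and let K be the number of odd legs.
--
-- If every vertex is blue at round J, then among the sources placed by then
-- every leg contains its leaf and an endpoint of each of its edges, and the centre is a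
-- source or two legs have their first vertex placed.  A vertex cover of a path on m
-- vertices has at least ⌊m/2⌋ vertices, ⌈m/2⌉ if it contains an end and ⌊m/2⌋ + 1 if it
-- contains both, so at least t₂ = Q + K + [K ≤ 1] distinct sources are placed by round J.  When
-- K ∈ {0, 2} the same count already applies before the last round, where the only leaf
-- that may be missing is that of the last source; hence J ≥ b₂ = t₂ + [K ∈ {0, 2}].
--
-- Placing every other vertex of each leg, ending at its leaf, lets all other
-- leg vertices turn blue in a single round once the centre is blue.  The centre is placed
-- first when K ≤ 1; otherwise the first vertices of two odd legs are placed first.  When
-- K = 1 or K ≥ 3 one odd leg takes the complementary vertices and its leaf is placed
-- last, so that the last round also places a source.

open import Defs
open import Data.Nat
  using (ℕ; zero; suc; _+_; _≤_; _<_; _∸_; _%_; _⊓_; z≤n; s≤s; s≤s⁻¹; _≤′_; ≤′-refl; ≤′-step; ⌊_/2⌋; ⌈_/2⌉)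
open import Data.Nat.Properties hiding (_≟_)
open import Data.Nat.DivMod using (m%n<n)
open import Data.Fin using (Fin; toℕ; fromℕ; fromℕ<; punchIn; punchOut) renaming (zero to fzero; suc to fsuc)
import Data.Fin.Properties as Fin
import Data.Nat as ℕ
open import Data.Fin.Properties using (punchInᵢ≢i; punchIn-punchOut; toℕ-injective; toℕ-fromℕ; toℕ-fromℕ<)
open import Data.Vec.Functional using (removeAt; updateAt)
open import Data.Vec.Functional.Properties using (updateAt-updates; updateAt-minimal)
open import Algebra.Properties.CommutativeMonoid.Sum +-0-commutativeMonoid
  using (sum; sum-remove; sum-replicate-zero; ∑-distrib-+; sum-cong-≗)
open import Data.Bool using (Bool; true; false; not)
open import Data.Bool.Properties using (not-involutive)
open import Data.List using (List; []; _∷_; length; take; map; _++_)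
open import Data.List.Membership.Propositional using (_∈_)
open import Data.List.Relation.Binary.Subset.Propositional using (_⊆_)
open import Data.List.Properties using (length-take; length-map; length-++; take-all)
open import Data.List.Membership.Propositional.Properties using (∈-map⁺; ∈-++⁺ˡ; ∈-++⁺ʳ)
open import Data.List.Relation.Unary.Any using (here; there)
open import Data.Product using (Σ; _×_; _,_; proj₁; proj₂)
open import Data.Sum using (_⊎_; inj₁; inj₂)
import Data.Sum as Sum
open import Algebra.Properties.CommutativeSemigroup +-commutativeSemigroup using (interchange; x∙yz≈y∙xz)
open import Function using (_∘_; id)
open import Relation.Binary.PropositionalEquality
open import Relation.Binary.Definitions using (DecidableEquality)
open import Relation.Nullary using (¬_; Dec; yes; no)
open import Data.Empty using (⊥-elim)

∑-mono-≤ : ∀ {m} {f g : Fin m → ℕ} → (∀ i → f i ≤ g i) → sum f ≤ sum g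
∑-mono-≤ {zero}  f≤g = z≤n
∑-mono-≤ {suc m} f≤g = +-mono-≤ (f≤g fzero) (∑-mono-≤ (f≤g ∘ fsuc))

∑-removeAt-≤ : ∀ {m} (f : Fin (suc m) → ℕ) i → sum (removeAt f i) ≤ sum f
∑-removeAt-≤ f i = ≤-trans (m≤n+m _ (f i)) (≤-reflexive (sym (sum-remove f)))

≤-∑ : ∀ {m} (f : Fin m → ℕ) i → f i ≤ sum f
≤-∑ {suc m} f i = ≤-trans (m≤m+n (f i) _) (≤-reflexive (sym (sum-remove f)))

pair-≤-∑ : ∀ {m} (f : Fin m → ℕ) {i j} → i ≢ j → f i + f j ≤ sum f
pair-≤-∑ {suc m} f {i} {j} i≢j = begin
  f i + f j                                ≡⟨ cong (λ k → f i + f k) (punchIn-punchOut i≢j) ⟨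
  f i + removeAt f i (punchOut i≢j)        ≤⟨ +-monoʳ-≤ (f i) (≤-∑ (removeAt f i) _) ⟩
  f i + sum (removeAt f i)                 ≡⟨ sum-remove f ⟨
  sum f                                    ∎
  where open ≤-Reasoning

∑-mono-≤-except : ∀ {m} {f g : Fin m → ℕ} i → (∀ j → j ≢ i → f j ≤ g j) → sum f ≤ f i + sum g
∑-mono-≤-except {suc m} {f} {g} i f≤g = begin
  sum f                     ≡⟨ sum-remove f ⟩
  f i + sum (removeAt f i)  ≤⟨ +-monoʳ-≤ (f i) (∑-mono-≤ (λ j → f≤g (punchIn i j) (punchInᵢ≢i i j))) ⟩
  f i + sum (removeAt g i)  ≤⟨ +-monoʳ-≤ (f i) (∑-removeAt-≤ g i) ⟩
  f i + sum g               ∎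
  where open ≤-Reasoning

∑-zero : ∀ {m} {f : Fin m → ℕ} → (∀ i → f i ≡ 0) → sum f ≡ 0
∑-zero {m} f≗0 = trans (sum-cong-≗ f≗0) (sum-replicate-zero m)

∑-≤-single : ∀ {m} {f : Fin m → ℕ} i → (∀ j → j ≢ i → f j ≡ 0) → sum f ≤ f i
∑-≤-single {m} {f} i f≡0 = begin
  sum f                     ≤⟨ ∑-mono-≤-except {g = λ _ → 0} i (λ j j≢i → ≤-reflexive (f≡0 j j≢i)) ⟩
  f i + sum {m} (λ _ → 0)   ≡⟨ cong (f i +_) (∑-zero {m} λ _ → refl) ⟩
  f i + 0                   ≡⟨ +-identityʳ (f i) ⟩
  f i                       ∎
  where open ≤-Reasoning

∑-∸ : ∀ {m} {f g : Fin m → ℕ} → (∀ i → f i ≤ g i) → sum f + sum (λ i → g i ∸ f i) ≡ sum g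
∑-∸ {f = f} {g} f≤g = begin
  sum f + sum (λ i → g i ∸ f i)  ≡⟨ ∑-distrib-+ f _ ⟨
  sum (λ i → f i + (g i ∸ f i))  ≡⟨ sum-cong-≗ (λ i → m+[n∸m]≡n (f≤g i)) ⟩
  sum g                          ∎
  where open ≡-Reasoning

∀⊎-distrib : ∀ {m} {P : Fin m → Set} {Q : Set} → (∀ i → P i ⊎ Q) → (∀ i → P i) ⊎ Q
∀⊎-distrib {zero}  _ = inj₁ λ ()
∀⊎-distrib {suc m} h with h fzero | ∀⊎-distrib (h ∘ fsuc)
... | inj₂ q  | _        = inj₂ q
... | inj₁ _  | inj₂ q   = inj₂ q
... | inj₁ p₀ | inj₁ ps  = inj₁ λ { fzero → p₀ ; (fsuc i) → ps i }

𝟙 : ∀ {p} {P : Set p} → Dec P → ℕ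
𝟙 (yes _) = 1
𝟙 (no _)  = 0

𝟙≤1 : ∀ {p} {P : Set p} (P? : Dec P) → 𝟙 P? ≤ 1
𝟙≤1 (yes _) = s≤s z≤n
𝟙≤1 (no _)  = z≤n

𝟙-yes : ∀ {p} {P : Set p} (P? : Dec P) → P → 𝟙 P? ≡ 1
𝟙-yes (yes _) _  = refl
𝟙-yes (no ¬P) pf = ⊥-elim (¬P pf)

𝟙-no : ∀ {p} {P : Set p} (P? : Dec P) → ¬ P → 𝟙 P? ≡ 0
𝟙-no (yes pf) ¬P = ⊥-elim (¬P pf)
𝟙-no (no _)   _  = refl

count : ∀ {m} {P : Fin m → Set} → (∀ p → Dec (P p)) → ℕ
count P? = sum (λ p → 𝟙 (P? p))

pick₁ : ∀ {m} {P : Fin m → Set} (P? : ∀ i → Dec (P i)) → 1 ≤ count P? → Σ (Fin m) P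
pick₁ {suc m} P? h with P? fzero
... | yes P₀ = fzero , P₀
... | no _   = let i , Pi = pick₁ (P? ∘ fsuc) h in fsuc i , Pi

pick₂ : ∀ {m} {P : Fin m → Set} (P? : ∀ i → Dec (P i)) → 2 ≤ count P? →
        Σ (Fin m) λ i → Σ (Fin m) λ j → i ≢ j × P i × P j
pick₂ {suc m} P? h with P? fzero
... | yes P₀ = let j , Pj = pick₁ (P? ∘ fsuc) (s≤s⁻¹ h) in fzero , fsuc j , (λ ()) , P₀ , Pj
... | no _   = let i , j , i≢j , Pi , Pj = pick₂ (P? ∘ fsuc) h in
               fsuc i , fsuc j , i≢j ∘ Fin.suc-injective , Pi , Pj

pick₃ : ∀ {m} {P : Fin m → Set} (P? : ∀ i → Dec (P i)) → 3 ≤ count P? →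
        Σ (Fin m) λ i → Σ (Fin m) λ j → Σ (Fin m) λ k → i ≢ j × i ≢ k × j ≢ k × P i × P j × P k
pick₃ {suc m} P? h with P? fzero
... | yes P₀ = let j , k , j≢k , Pj , Pk = pick₂ (P? ∘ fsuc) (s≤s⁻¹ h) in
               fzero , fsuc j , fsuc k , (λ ()) , (λ ()) , j≢k ∘ Fin.suc-injective , P₀ , Pj , Pk
... | no _   = let i , j , k , i≢j , i≢k , j≢k , Pi , Pj , Pk = pick₃ (P? ∘ fsuc) h in
               fsuc i , fsuc j , fsuc k , i≢j ∘ Fin.suc-injective , i≢k ∘ Fin.suc-injective ,
               j≢k ∘ Fin.suc-injective , Pi , Pj , Pk

⌊/2⌋-≤ : ∀ k x → k ≤ suc (x + x) → ⌊ k /2⌋ ≤ x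
⌊/2⌋-≤ k x k≤ = ≤-trans (⌊n/2⌋-mono k≤) (≤-reflexive (sym (n≡⌈n+n/2⌉ x)))

⌈n/2⌉≡⌊n/2⌋+n%2 : ∀ n → ⌈ n /2⌉ ≡ ⌊ n /2⌋ + n % 2
⌈n/2⌉≡⌊n/2⌋+n%2 zero          = refl
⌈n/2⌉≡⌊n/2⌋+n%2 (suc zero)    = refl
⌈n/2⌉≡⌊n/2⌋+n%2 (suc (suc n)) = cong suc (⌈n/2⌉≡⌊n/2⌋+n%2 n)

n%2≤1 : ∀ n → n % 2 ≤ 1
n%2≤1 n = ≤-pred (m%n<n n 2)

%2≡𝟙 : ∀ m → m % 2 ≡ 𝟙 (m % 2 ℕ.≟ 1)
%2≡𝟙 0             = refl
%2≡𝟙 1             = refl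
%2≡𝟙 (suc (suc m)) = %2≡𝟙 m

odd : ℕ → Bool
odd zero    = false
odd (suc k) = not (odd k)

%2≡1⇒odd : ∀ m → m % 2 ≡ 1 → odd m ≡ true
%2≡1⇒odd 1             _      = refl
%2≡1⇒odd (suc (suc m)) m%2≡1 = trans (not-involutive (odd m)) (%2≡1⇒odd m m%2≡1)

even⇒⌊/2⌋≡⌈/2⌉ : ∀ m → odd m ≡ false → ⌊ m /2⌋ ≡ ⌈ m /2⌉
even⇒⌊/2⌋≡⌈/2⌉ zero          _    = refl
even⇒⌊/2⌋≡⌈/2⌉ (suc (suc m)) even = cong suc (even⇒⌊/2⌋≡⌈/2⌉ m (trans (sym (not-involutive (odd m))) even))

onPhase : Bool → ℕ → Bool
onPhase b zero    = b
onPhase b (suc k) = onPhase (not b) k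

onPhase-suc : ∀ b k → onPhase b (suc k) ≡ not (onPhase b k)
onPhase-suc b zero    = refl
onPhase-suc b (suc k) = onPhase-suc (not b) k

onPhase-next : ∀ {b k} → onPhase b k ≡ false → onPhase b (suc k) ≡ true
onPhase-next {b} {k} off = trans (onPhase-suc b k) (cong not off)

onPhase-prev : ∀ {b k} → onPhase b (suc k) ≡ false → onPhase b k ≡ true
onPhase-prev {b} {k} off = trans (sym (not-involutive _)) (cong not (trans (sym (onPhase-suc b k)) off))

onPhase-last : ∀ k → onPhase (odd (suc k)) k ≡ true
onPhase-last zero    = refl
onPhase-last (suc k) = trans (cong (λ b → onPhase b k) (not-involutive _)) (onPhase-last k)

-- Vertex covers of a path

Covers : ∀ {m} → (Fin m → Set) → Set
Covers P = ∀ p p' → toℕ p' ≡ suc (toℕ p) → P p ⊎ P p'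

cover-path : ∀ m {P : Fin (suc m) → Set} (P? : ∀ p → Dec (P p)) → Covers P →
             𝟙 (P? fzero) + 𝟙 (P? (fromℕ m)) + suc m ≤ suc (count P? + count P?)
cover-path zero P? _ with P? fzero
... | yes _ = ≤-refl
... | no _  = ≤-refl
cover-path (suc m) P? cov
  with cover-path m (P? ∘ fsuc) (λ p p' eq → cov (fsuc p) (fsuc p') (cong suc eq)) | P? fzero
... | ih | yes _ = begin
  suc (ℓ + suc (suc m))         ≡⟨ cong suc (+-suc ℓ (suc m)) ⟩
  suc (suc (ℓ + suc m))         ≤⟨ s≤s (s≤s (≤-trans (m≤n+m _ e) (≤-reflexive (sym (+-assoc e ℓ (suc m)))))) ⟩
  suc (suc (e + ℓ + suc m))     ≤⟨ s≤s (s≤s ih) ⟩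
  suc (suc (suc (c + c)))       ≡⟨ cong (suc ∘ suc) (+-suc c c) ⟨
  suc (suc (c + suc c))         ∎
  where open ≤-Reasoning
        e = 𝟙 (P? (fsuc fzero))
        ℓ = 𝟙 (P? (fromℕ (suc m)))
        c = count (P? ∘ fsuc)
... | ih | no ¬P₀ with cov fzero (fsuc fzero) refl
...   | inj₁ P₀ = ⊥-elim (¬P₀ P₀)
...   | inj₂ P₁ = begin
  ℓ + suc (suc m)               ≡⟨ +-suc ℓ (suc m) ⟩
  suc (ℓ + suc m)               ≡⟨ cong (λ e → e + ℓ + suc m) (𝟙-yes (P? (fsuc fzero)) P₁) ⟨
  𝟙 (P? (fsuc fzero)) + ℓ + suc m ≤⟨ ih ⟩
  suc (count (P? ∘ fsuc) + count (P? ∘ fsuc)) ∎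
  where open ≤-Reasoning
        ℓ = 𝟙 (P? (fromℕ (suc m)))

HasFirst : ∀ {m} → (Fin m → Set) → Set
HasFirst {m} P = Σ (Fin m) λ p → toℕ p ≡ 0 × P p

HasLast : ∀ {m} → (Fin m → Set) → Set
HasLast {m} P = ∀ p → suc (toℕ p) ≡ m → P p

private
  module CoverPath {m : ℕ} {P : Fin (suc m) → Set} (P? : ∀ p → Dec (P p)) (cov : Covers P) where

    ⌊/2⌋-≤-count : ∀ k → k ≤ 𝟙 (P? fzero) + 𝟙 (P? (fromℕ m)) → ⌊ k + suc m /2⌋ ≤ count P?
    ⌊/2⌋-≤-count k k≤ = ⌊/2⌋-≤ _ _ (≤-trans (+-monoˡ-≤ (suc m) k≤) (cover-path m P? cov))

    𝟙-first : HasFirst P → 𝟙 (P? fzero) ≡ 1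
    𝟙-first (p , p≡0 , Pp) = 𝟙-yes (P? fzero) (subst P (toℕ-injective p≡0) Pp)

    𝟙-last : HasLast P → 𝟙 (P? (fromℕ m)) ≡ 1
    𝟙-last last = 𝟙-yes (P? (fromℕ m)) (last (fromℕ m) (cong suc (toℕ-fromℕ m)))

cover-⌊/2⌋ : ∀ {m} {P : Fin m → Set} (P? : ∀ p → Dec (P p)) → Covers P → ⌊ m /2⌋ ≤ count P?
cover-⌊/2⌋ {zero}  _  _   = z≤n
cover-⌊/2⌋ {suc m} P? cov = ⌊/2⌋-≤-count 0 z≤n
  where open CoverPath P? cov

cover-⌈/2⌉ : ∀ {m} {P : Fin m → Set} (P? : ∀ p → Dec (P p)) → Covers P →
             HasFirst P ⊎ HasLast P → ⌈ m /2⌉ ≤ count P?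
cover-⌈/2⌉ {zero}  _  _   _             = z≤n
cover-⌈/2⌉ {suc m} P? cov (inj₁ first) =
  ⌊/2⌋-≤-count 1 (≤-trans (≤-reflexive (sym (𝟙-first first))) (m≤m+n _ _))
  where open CoverPath P? cov
cover-⌈/2⌉ {suc m} P? cov (inj₂ last)  =
  ⌊/2⌋-≤-count 1 (≤-trans (≤-reflexive (sym (𝟙-last last))) (m≤n+m _ _))
  where open CoverPath P? cov

cover-both : ∀ {m} {P : Fin m → Set} (P? : ∀ p → Dec (P p)) → Covers P →
             HasFirst P → HasLast P → suc ⌊ m /2⌋ ≤ count P?
cover-both {suc m} P? cov first last =
  ⌊/2⌋-≤-count 2 (≤-reflexive (sym (cong₂ _+_ (𝟙-first first) (𝟙-last last))))
  where open CoverPath P? cov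

module _ {A : Set} where

  ∈-take⇒SourceAt : ∀ (s : List A) {j v} → v ∈ take j s → Σ ℕ λ i → i < j × SourceAt s i v
  ∈-take⇒SourceAt (x ∷ s) {suc j} (here refl) = 0 , s≤s z≤n , refl
  ∈-take⇒SourceAt (x ∷ s) {suc j} (there v∈) =
    let i , i<j , src = ∈-take⇒SourceAt s v∈ in suc i , s≤s i<j , src

  SourceAt⇒∈-take : ∀ (s : List A) {i j v} → SourceAt s i v → i < j → v ∈ take j s
  SourceAt⇒∈-take (x ∷ s) {zero}  {suc j} refl _         = here refl
  SourceAt⇒∈-take (x ∷ s) {suc i} {suc j} src  (s≤s i<j) = there (SourceAt⇒∈-take s src i<j)

  SourceAt-functional : ∀ (s : List A) {i u v} → SourceAt s i u → SourceAt s i v → u ≡ v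
  SourceAt-functional (x ∷ s) {zero}  refl refl = refl
  SourceAt-functional (x ∷ s) {suc i} su   sv   = SourceAt-functional s su sv

  take-mono : ∀ (s : List A) {j k} → j ≤ k → take j s ⊆ take k s
  take-mono s j≤k v∈ = let i , i<j , src = ∈-take⇒SourceAt s v∈ in SourceAt⇒∈-take s src (≤-trans i<j j≤k)

  ∈-take-suc⁻ : ∀ (s : List A) {j v} → v ∈ take (suc j) s → v ∈ take j s ⊎ SourceAt s j v
  ∈-take-suc⁻ s v∈ with ∈-take⇒SourceAt s v∈
  ... | i , i<1+j , src with m≤n⇒m<n∨m≡n (≤-pred i<1+j)
  ...   | inj₁ i<j  = inj₁ (SourceAt⇒∈-take s src i<j)
  ...   | inj₂ refl = inj₂ src

  ∈-take-length : ∀ (xs : List A) {ys v} → v ∈ xs → v ∈ take (length xs) (xs ++ ys)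
  ∈-take-length (x ∷ xs) (here v≡x)  = here v≡x
  ∈-take-length (x ∷ xs) (there v∈) = there (∈-take-length xs v∈)

  ∈-take-++ : ∀ (xs : List A) {ys k v} → v ∈ take k ys → v ∈ take (length xs + k) (xs ++ ys)
  ∈-take-++ []       v∈ = v∈
  ∈-take-++ (x ∷ xs) v∈ = there (∈-take-++ xs v∈)

  ∈⇒1≤length : ∀ {xs : List A} {v} → v ∈ xs → 1 ≤ length xs
  ∈⇒1≤length (here _)  = s≤s z≤n
  ∈⇒1≤length (there _) = s≤s z≤n

  module _ (Adj : A → A → Set) (s : List A) where

    Blue-mono : ∀ {j k v} → j ≤ k → Blue Adj s j v → Blue Adj s k v
    Blue-mono j≤k = go (≤⇒≤′ j≤k)
      where
      go : ∀ {j k v} → j ≤′ k → Blue Adj s j v → Blue Adj s k v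
      go ≤′-refl        b = b
      go (≤′-step j≤′k) b = inj₁ (go j≤′k b)

    placed⇒Blue : ∀ {j v} → v ∈ take j s → Blue Adj s j v
    placed⇒Blue v∈ = let i , i<j , src = ∈-take⇒SourceAt s v∈ in Blue-mono i<j (inj₂ (inj₁ src))

concatFin : ∀ {A : Set} {m} → (Fin m → List A) → List A
concatFin {m = zero}  _ = []
concatFin {m = suc m} g = g fzero ++ concatFin (g ∘ fsuc)

∈-concatFin : ∀ {A : Set} {m} (g : Fin m → List A) i {x} → x ∈ g i → x ∈ concatFin g
∈-concatFin g fzero    x∈ = ∈-++⁺ˡ x∈
∈-concatFin g (fsuc i) x∈ = ∈-++⁺ʳ (g fzero) (∈-concatFin (g ∘ fsuc) i x∈)

length-concatFin : ∀ {A : Set} {m} (g : Fin m → List A) → length (concatFin g) ≡ sum (length ∘ g)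
length-concatFin {m = zero}  g = refl
length-concatFin {m = suc m} g =
  trans (length-++ (g fzero)) (cong (length (g fzero) +_) (length-concatFin (g ∘ fsuc)))

-- The spider

module Spider (r : ℕ) (n : Fin r → ℕ) where

  V : Set
  V = SpiderV r n

  Adj : V → V → Set
  Adj = SpiderAdj r n

  leg-injective : ∀ {i} {p p' : Fin (n i)} → leg {r} {n} i p ≡ leg i p' → p ≡ p'
  leg-injective refl = refl

  _≟_ : DecidableEquality V
  centre  ≟ centre    = yes refl
  centre  ≟ leg _ _   = no λ ()
  leg _ _ ≟ centre    = no λ ()
  leg i p ≟ leg i' p' with i Fin.≟ i'
  ... | no i≢i' = no λ { refl → i≢i' refl }
  ... | yes refl with p Fin.≟ p'
  ...   | yes refl = yes refl
  ...   | no p≢p'  = no (p≢p' ∘ leg-injective)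

  data LegNeighbour (i : Fin r) (p : Fin (n i)) : V → Set where
    prev-centre : toℕ p ≡ 0 → LegNeighbour i p centre
    prev-leg    : ∀ p⁻ → toℕ p ≡ suc (toℕ p⁻) → LegNeighbour i p (leg i p⁻)
    next-leg    : ∀ p⁺ → toℕ p⁺ ≡ suc (toℕ p) → LegNeighbour i p (leg i p⁺)

  leg-neighbour : ∀ {u i p} → Adj u (leg i p) → LegNeighbour i p u
  leg-neighbour (inj₁ (centre-leg _ _ p≡0))  = prev-centre p≡0
  leg-neighbour (inj₁ (leg-leg _ p⁻ _ p≡1+)) = prev-leg p⁻ p≡1+
  leg-neighbour (inj₂ (leg-leg _ _ p⁺ p⁺≡1+)) = next-leg p⁺ p⁺≡1+

  Spread : (V → Set) → V → Set
  Spread B v = Σ V λ u → Σ V λ w → ¬ u ≡ w × Adj u v × Adj w v × B u × B w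

  NextIn : (V → Set) → (i : Fin r) → Fin (n i) → Set
  NextIn B i p = Σ (Fin (n i)) λ p⁺ → toℕ p⁺ ≡ suc (toℕ p) × B (leg i p⁺)

  PrevIn : (V → Set) → (i : Fin r) → Fin (n i) → Set
  PrevIn B i p = (toℕ p ≡ 0 × B centre) ⊎ (Σ (Fin (n i)) λ p⁻ → toℕ p ≡ suc (toℕ p⁻) × B (leg i p⁻))

  FirstIn : (V → Set) → Fin r → Set
  FirstIn B i = HasFirst λ p → B (leg i p)

  TwoFirstsIn : (V → Set) → Set
  TwoFirstsIn B = Σ (Fin r) λ i₁ → Σ (Fin r) λ i₂ → i₁ ≢ i₂ × FirstIn B i₁ × FirstIn B i₂

  spread-leg : ∀ {B i p} → Spread B (leg i p) → PrevIn B i p × NextIn B i p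
  spread-leg {B} {i} {p} (u , w , u≢w , u~ , w~ , Bu , Bw) = go (leg-neighbour u~) (leg-neighbour w~) u≢w Bu Bw
    where
    go : ∀ {u w} → LegNeighbour i p u → LegNeighbour i p w → u ≢ w → B u → B w → PrevIn B i p × NextIn B i p
    go (prev-centre p≡0)  (next-leg p⁺ eq)   _ Bu Bw = inj₁ (p≡0 , Bu) , (p⁺ , eq , Bw)
    go (prev-leg p⁻ eq)   (next-leg p⁺ eq')  _ Bu Bw = inj₂ (p⁻ , eq , Bu) , (p⁺ , eq' , Bw)
    go (next-leg p⁺ eq')  (prev-centre p≡0)  _ Bu Bw = inj₁ (p≡0 , Bw) , (p⁺ , eq' , Bu)
    go (next-leg p⁺ eq')  (prev-leg p⁻ eq)   _ Bu Bw = inj₂ (p⁻ , eq , Bw) , (p⁺ , eq' , Bu)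
    go (prev-centre _)    (prev-centre _)    u≢w _ _ = ⊥-elim (u≢w refl)
    go (prev-centre p≡0)  (prev-leg _ eq)    _ _ _   = ⊥-elim (0≢1+n (trans (sym p≡0) eq))
    go (prev-leg _ eq)    (prev-centre p≡0)  _ _ _   = ⊥-elim (0≢1+n (trans (sym p≡0) eq))
    go (prev-leg _ eq)    (prev-leg _ eq')   u≢w _ _ =
      ⊥-elim (u≢w (cong (leg i) (toℕ-injective (suc-injective (trans (sym eq) eq')))))
    go (next-leg _ eq)    (next-leg _ eq')   u≢w _ _ =
      ⊥-elim (u≢w (cong (leg i) (toℕ-injective (trans eq (sym eq')))))

  spread-of-neighbours : ∀ {B i p} → PrevIn B i p → NextIn B i p → Spread B (leg i p)
  spread-of-neighbours {i = i} {p} (inj₁ (p≡0 , Bc)) (p⁺ , eq⁺ , B⁺) =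
    leg i p⁺ , centre , (λ ()) , inj₂ (leg-leg i p p⁺ eq⁺) , inj₁ (centre-leg i p p≡0) , B⁺ , Bc
  spread-of-neighbours {i = i} {p} (inj₂ (p⁻ , eq⁻ , B⁻)) (p⁺ , eq⁺ , B⁺) =
    leg i p⁺ , leg i p⁻ , p⁺≢p⁻ , inj₂ (leg-leg i p p⁺ eq⁺) , inj₁ (leg-leg i p⁻ p eq⁻) , B⁺ , B⁻
    where
    p⁺≢p⁻ : leg i p⁺ ≢ leg i p⁻
    p⁺≢p⁻ eq = <⇒≢ (m<n⇒m<1+n (n<1+n _)) (trans (cong toℕ (sym (leg-injective eq))) (trans eq⁺ (cong suc eq⁻)))

  spread-centre : ∀ {B} → Spread B centre → TwoFirstsIn B
  spread-centre (_ , _ , u≢w , inj₂ (centre-leg i₁ p₁ p₁≡0) , inj₂ (centre-leg i₂ p₂ p₂≡0) , B₁ , B₂) =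
    i₁ , i₂ , i₁≢i₂ , (p₁ , p₁≡0 , B₁) , (p₂ , p₂≡0 , B₂)
    where
    i₁≢i₂ : i₁ ≢ i₂
    i₁≢i₂ refl = u≢w (cong (leg i₁) (toℕ-injective (trans p₁≡0 (sym p₂≡0))))

  spread-of-firsts : ∀ {B} → TwoFirstsIn B → Spread B centre
  spread-of-firsts (i₁ , i₂ , i₁≢i₂ , (p₁ , p₁≡0 , B₁) , (p₂ , p₂≡0 , B₂)) =
    leg i₁ p₁ , leg i₂ p₂ , (λ { refl → i₁≢i₂ refl }) ,
    inj₂ (centre-leg i₁ p₁ p₁≡0) , inj₂ (centre-leg i₂ p₂ p₂≡0) , B₁ , B₂

  next-is : ∀ {B i} {p p' : Fin (n i)} → toℕ p' ≡ suc (toℕ p) → NextIn B i p → B (leg i p')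
  next-is {B} {i} p'≡1+p (p⁺ , p⁺≡1+p , B⁺) =
    subst (λ q → B (leg i q)) (toℕ-injective (trans p⁺≡1+p (sym p'≡1+p))) B⁺

  prev-is : ∀ {B i} {p p' : Fin (n i)} → toℕ p' ≡ suc (toℕ p) → PrevIn B i p' → B (leg i p)
  prev-is p'≡1+p (inj₁ (p'≡0 , _))                    = ⊥-elim (0≢1+n (trans (sym p'≡0) p'≡1+p))
  prev-is {B} {i} p'≡1+p (inj₂ (p⁻ , p'≡1+p⁻ , B⁻)) =
    subst (λ q → B (leg i q)) (toℕ-injective (suc-injective (trans (sym p'≡1+p⁻) p'≡1+p))) B⁻

  source-leg : Fin r → (s : List V) (j : ℕ) → Σ (Fin r) λ i* → ∀ {i p} → SourceAt s j (leg i p) → i ≡ i*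
  source-leg d []            _       = d , λ ()
  source-leg d (centre ∷ _)  zero    = d , λ ()
  source-leg d (leg i _ ∷ _) zero    = i , λ { refl → refl }
  source-leg d (_ ∷ s)       (suc j) = source-leg d s j

  CentreSupported : List V → Set
  CentreSupported L = centre ∈ L ⊎ TwoFirstsIn (_∈ L)

  CentreSupported-mono : ∀ {L L'} → L ⊆ L' → CentreSupported L → CentreSupported L'
  CentreSupported-mono L⊆L' (inj₁ c∈) = inj₁ (L⊆L' c∈)
  CentreSupported-mono L⊆L' (inj₂ (i₁ , i₂ , i₁≢i₂ , (p₁ , p₁≡0 , ∈₁) , (p₂ , p₂≡0 , ∈₂))) =
    inj₂ (i₁ , i₂ , i₁≢i₂ , (p₁ , p₁≡0 , L⊆L' ∈₁) , (p₂ , p₂≡0 , L⊆L' ∈₂))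

  LegsCovered : List V → Set
  LegsCovered L = ∀ i → Covers λ p → leg i p ∈ L

  LeafIn : List V → Fin r → Set
  LeafIn L i = HasLast λ p → leg i p ∈ L

  module Burning (s : List V) where

    BlueAt : ℕ → V → Set
    BlueAt = Blue Adj s

    Placed : ℕ → V → Set
    Placed j v = v ∈ take j s

    placed-suc : ∀ {j} → take j s ⊆ take (suc j) s
    placed-suc = take-mono s (n≤1+n _)

    source⇒placed : ∀ {j v} → SourceAt s j v → Placed (suc j) v
    source⇒placed src = SourceAt⇒∈-take s src ≤-refl

    last-blue⇒placed : ∀ {j i p} → suc (toℕ p) ≡ n i → BlueAt j (leg i p) → Placed j (leg i p)
    last-blue⇒placed {suc j} last (inj₁ b)             = placed-suc (last-blue⇒placed last b)
    last-blue⇒placed {suc j} last (inj₂ (inj₁ src))    = source⇒placed src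
    last-blue⇒placed {suc j} last (inj₂ (inj₂ spread)) =
      let p⁺ , p⁺≡1+p , _ = proj₂ (spread-leg spread) in
      ⊥-elim (<-irrefl (trans p⁺≡1+p last) (Fin.toℕ<n p⁺))

    edge-blue⇒placed : ∀ {j i} {p p' : Fin (n i)} → toℕ p' ≡ suc (toℕ p) →
                       BlueAt j (leg i p) ⊎ BlueAt j (leg i p') → Placed j (leg i p) ⊎ Placed j (leg i p')
    edge-blue⇒placed {zero}  _ (inj₁ ())
    edge-blue⇒placed {zero}  _ (inj₂ ())
    edge-blue⇒placed {suc j} {i} {p} {p'} p'≡1+p = step
      where
      earlier : BlueAt j (leg i p) ⊎ BlueAt j (leg i p') → Placed (suc j) (leg i p) ⊎ Placed (suc j) (leg i p')
      earlier b = Sum.map placed-suc placed-suc (edge-blue⇒placed p'≡1+p b)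

      step : BlueAt (suc j) (leg i p) ⊎ BlueAt (suc j) (leg i p') →
             Placed (suc j) (leg i p) ⊎ Placed (suc j) (leg i p')
      step (inj₁ (inj₁ b))             = earlier (inj₁ b)
      step (inj₁ (inj₂ (inj₁ src)))    = inj₁ (source⇒placed src)
      step (inj₁ (inj₂ (inj₂ spread))) = earlier (inj₂ (next-is {BlueAt j} p'≡1+p (proj₂ (spread-leg spread))))
      step (inj₂ (inj₁ b))             = earlier (inj₂ b)
      step (inj₂ (inj₂ (inj₁ src)))    = inj₂ (source⇒placed src)
      step (inj₂ (inj₂ (inj₂ spread))) = earlier (inj₁ (prev-is {BlueAt j} p'≡1+p (proj₁ (spread-leg spread))))

    mutual
      centre-blue⇒supported : ∀ {j} → BlueAt j centre → CentreSupported (take j s)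
      centre-blue⇒supported {suc j} (inj₁ b)             =
        CentreSupported-mono placed-suc (centre-blue⇒supported b)
      centre-blue⇒supported {suc j} (inj₂ (inj₁ src))    = inj₁ (source⇒placed src)
      centre-blue⇒supported {suc j} (inj₂ (inj₂ spread)) =
        CentreSupported-mono placed-suc (spread-centre⇒supported spread)

      spread-centre⇒supported : ∀ {j} → Spread (BlueAt j) centre → CentreSupported (take j s)
      spread-centre⇒supported spread with spread-centre spread
      ... | i₁ , i₂ , i₁≢i₂ , (p₁ , p₁≡0 , b₁) , (p₂ , p₂≡0 , b₂)
          with first-blue⇒placed-or-supported p₁≡0 b₁ | first-blue⇒placed-or-supported p₂≡0 b₂
      ...   | inj₂ sup  | _         = sup
      ...   | inj₁ _    | inj₂ sup  = sup
      ...   | inj₁ pl₁  | inj₁ pl₂  = inj₂ (i₁ , i₂ , i₁≢i₂ , (p₁ , p₁≡0 , pl₁) , (p₂ , p₂≡0 , pl₂))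

      first-blue⇒placed-or-supported : ∀ {j i p} → toℕ p ≡ 0 → BlueAt j (leg i p) →
                                       Placed j (leg i p) ⊎ CentreSupported (take j s)
      first-blue⇒placed-or-supported {suc j} p≡0 (inj₁ b) =
        Sum.map placed-suc (CentreSupported-mono placed-suc) (first-blue⇒placed-or-supported p≡0 b)
      first-blue⇒placed-or-supported {suc j} p≡0 (inj₂ (inj₁ src)) = inj₁ (source⇒placed src)
      first-blue⇒placed-or-supported {suc j} p≡0 (inj₂ (inj₂ spread)) with proj₁ (spread-leg spread)
      ... | inj₁ (_ , bc)         = inj₂ (CentreSupported-mono placed-suc (centre-blue⇒supported bc))
      ... | inj₂ (_ , p≡1+p⁻ , _) = ⊥-elim (0≢1+n (trans (sym p≡0) p≡1+p⁻))

    module _ {j} (all : AllBlue Adj s (suc j)) where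

      -- Both ends of an unplaced leg edge would have to be the single source of round j + 1.
      allBlue⇒covered : LegsCovered (take j s)
      allBlue⇒covered i p p' p'≡1+p with all (leg i p) | all (leg i p')
      ... | inj₁ b                | _                      = edge-blue⇒placed p'≡1+p (inj₁ b)
      ... | inj₂ (inj₂ spread)    | _                      =
        edge-blue⇒placed p'≡1+p (inj₂ (next-is {BlueAt j} p'≡1+p (proj₂ (spread-leg spread))))
      ... | inj₂ (inj₁ _)         | inj₁ b'                = edge-blue⇒placed p'≡1+p (inj₂ b')
      ... | inj₂ (inj₁ _)         | inj₂ (inj₂ spread')    =
        edge-blue⇒placed p'≡1+p (inj₁ (prev-is {BlueAt j} p'≡1+p (proj₁ (spread-leg spread'))))
      ... | inj₂ (inj₁ src)       | inj₂ (inj₁ src')       =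
        ⊥-elim (1+n≢n (sym (trans (cong toℕ (leg-injective (SourceAt-functional s src src'))) p'≡1+p)))

      allBlue⇒leaves-but-source : ∀ i p → suc (toℕ p) ≡ n i → Placed j (leg i p) ⊎ SourceAt s j (leg i p)
      allBlue⇒leaves-but-source i p last = ∈-take-suc⁻ s (last-blue⇒placed last (all (leg i p)))

      allBlue⇒leaves-but-one : Fin r → Σ (Fin r) λ i* → ∀ i → i ≢ i* → LeafIn (take j s) i
      allBlue⇒leaves-but-one d = i* , λ i i≢i* p last →
        Sum.[ id , (λ src → ⊥-elim (i≢i* (only src))) ] (allBlue⇒leaves-but-source i p last)
        where
        i* = proj₁ (source-leg d s j)
        only = proj₂ (source-leg d s j)

      allBlue⇒supported-or-firsts : (∀ i → 1 ≤ n i) → CentreSupported (take j s) ⊎ (∀ i → FirstIn (Placed j) i)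
      allBlue⇒supported-or-firsts hn with all centre
      ... | inj₁ b             = inj₁ (centre-blue⇒supported b)
      ... | inj₂ (inj₂ spread) = inj₁ (spread-centre⇒supported spread)
      ... | inj₂ (inj₁ src)    = Sum.swap (∀⊎-distrib first-or-supported)
        where
        first-or-supported : ∀ i → FirstIn (Placed j) i ⊎ CentreSupported (take j s)
        first-or-supported i with all (leg i (fromℕ< (hn i)))
        ... | inj₁ b = Sum.map₁ (λ pl → _ , p≡0 , pl) (first-blue⇒placed-or-supported p≡0 b)
          where p≡0 = toℕ-fromℕ< (hn i)
        ... | inj₂ (inj₁ src')  = ⊥-elim (centre≢leg (SourceAt-functional s src src'))
          where centre≢leg : ∀ {p} → centre ≢ leg i p
                centre≢leg ()
        ... | inj₂ (inj₂ spread) with proj₁ (spread-leg spread)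
        ...   | inj₁ (_ , bc)         = inj₂ (centre-blue⇒supported bc)
        ...   | inj₂ (_ , p≡1+p⁻ , _) = ⊥-elim (0≢1+n (trans (sym (toℕ-fromℕ< (hn i))) p≡1+p⁻))

  open import Data.List.Membership.DecPropositional _≟_ public using (_∈?_)

  legCount : List V → Fin r → ℕ
  legCount L i = count λ p → leg i p ∈? L

  distinct : List V → ℕ
  distinct L = 𝟙 (centre ∈? L) + sum (legCount L)

  private
    ∑V : (V → ℕ) → ℕ
    ∑V f = f centre + sum λ i → sum λ p → f (leg i p)

    ∑V-mono-≤ : ∀ {f g} → (∀ v → f v ≤ g v) → ∑V f ≤ ∑V g
    ∑V-mono-≤ f≤g = +-mono-≤ (f≤g centre) (∑-mono-≤ λ i → ∑-mono-≤ λ p → f≤g (leg i p))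

    ∑V-distrib-+ : ∀ f g → ∑V (λ v → f v + g v) ≡ ∑V f + ∑V g
    ∑V-distrib-+ f g = begin
      f centre + g centre + sum (λ i → sum λ p → f (leg i p) + g (leg i p))
        ≡⟨ cong (f centre + g centre +_) (trans (sum-cong-≗ λ i → ∑-distrib-+ (f ∘ leg i) (g ∘ leg i))
                                                (∑-distrib-+ (λ i → sum (f ∘ leg i)) (λ i → sum (g ∘ leg i)))) ⟩
      f centre + g centre + (sum (λ i → sum λ p → f (leg i p)) + sum (λ i → sum λ p → g (leg i p)))
        ≡⟨ interchange (f centre) (g centre) _ _ ⟩
      ∑V f + ∑V g ∎
      where open ≡-Reasoning

    ∑V-zero : ∀ {f} → (∀ v → f v ≡ 0) → ∑V f ≡ 0
    ∑V-zero f≡0 = cong₂ _+_ (f≡0 centre) (∑-zero λ i → ∑-zero λ p → f≡0 (leg i p))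

    ∑V-point : ∀ a → ∑V (λ v → 𝟙 (v ≟ a)) ≤ 1
    ∑V-point centre = ≤-reflexive (cong suc (∑-zero λ i → ∑-zero {n i} λ _ → refl))
    ∑V-point (leg i₀ p₀) = begin
      sum (λ i → sum λ p → 𝟙 (leg i p ≟ leg i₀ p₀))
        ≤⟨ ∑-≤-single i₀ (λ i i≢i₀ → ∑-zero λ p → 𝟙-no (leg i p ≟ leg i₀ p₀) λ { refl → i≢i₀ refl }) ⟩
      sum (λ p → 𝟙 (leg i₀ p ≟ leg i₀ p₀))
        ≤⟨ ∑-≤-single p₀ (λ p p≢p₀ → 𝟙-no (leg i₀ p ≟ leg i₀ p₀) (p≢p₀ ∘ leg-injective)) ⟩
      𝟙 (leg i₀ p₀ ≟ leg i₀ p₀)                      ≤⟨ 𝟙≤1 (leg i₀ p₀ ≟ leg i₀ p₀) ⟩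
      1                                               ∎
      where open ≤-Reasoning

    𝟙-∈-∷ : ∀ a L v → 𝟙 (v ∈? a ∷ L) ≤ 𝟙 (v ≟ a) + 𝟙 (v ∈? L)
    𝟙-∈-∷ a L v with v ∈? a ∷ L
    ... | no _            = z≤n
    ... | yes (here v≡a)  = ≤-trans (≤-reflexive (sym (𝟙-yes (v ≟ a) v≡a))) (m≤m+n _ _)
    ... | yes (there v∈L) = ≤-trans (≤-reflexive (sym (𝟙-yes (v ∈? L) v∈L))) (m≤n+m _ _)

  distinct≤length : ∀ L → distinct L ≤ length L
  distinct≤length []      = ≤-reflexive (∑V-zero λ v → 𝟙-no (v ∈? []) λ ())
  distinct≤length (a ∷ L) = begin
    distinct (a ∷ L)                        ≤⟨ ∑V-mono-≤ (𝟙-∈-∷ a L) ⟩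
    ∑V (λ v → 𝟙 (v ≟ a) + 𝟙 (v ∈? L))       ≡⟨ ∑V-distrib-+ (λ v → 𝟙 (v ≟ a)) (λ v → 𝟙 (v ∈? L)) ⟩
    ∑V (λ v → 𝟙 (v ≟ a)) + distinct L       ≤⟨ +-mono-≤ (∑V-point a) (distinct≤length L) ⟩
    suc (length L)                          ∎
    where open ≤-Reasoning

-- Lower bound

countOdd≡∑ : ∀ r (n : Fin r → ℕ) → countOdd r n ≡ sum λ i → n i % 2
countOdd≡∑ zero    n = refl
countOdd≡∑ (suc r) n = cong (n fzero % 2 +_) (countOdd≡∑ r (n ∘ fsuc))

-- In the optimal schedules below the centre is itself a source iff K ≤ 1 (centreCost K),
-- and the last round places no source iff K ∈ {0, 2} (idleRound K).
centreCost : ℕ → ℕ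
centreCost 0 = 1
centreCost 1 = 1
centreCost _ = 0

idleRound : ℕ → ℕ
idleRound 0 = 1
idleRound 2 = 1
idleRound _ = 0

idleRound≡1 : ∀ {k} → k ≡ 0 ⊎ k ≡ 2 → idleRound k ≡ 1
idleRound≡1 (inj₁ refl) = refl
idleRound≡1 (inj₂ refl) = refl

idleRound≡0 : ∀ {k} → k ≡ 1 ⊎ 3 ≤ k → idleRound k ≡ 0
idleRound≡0 (inj₁ refl)                                    = refl
idleRound≡0 {suc zero}          (inj₂ (s≤s ()))
idleRound≡0 {suc (suc zero)}    (inj₂ (s≤s (s≤s ())))
idleRound≡0 {suc (suc (suc k))} (inj₂ _)                   = refl

k+centreCost≤1+k : ∀ k → k + centreCost k ≤ suc k
k+centreCost≤1+k 0             = ≤-refl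
k+centreCost≤1+k 1             = ≤-refl
k+centreCost≤1+k (suc (suc k)) = ≤-trans (≤-reflexive (+-identityʳ _)) (n≤1+n _)

k+centreCost≤ : ∀ k {x} → k ≤ x → 2 ≤ x → k + centreCost k ≤ x
k+centreCost≤ 0             _   2≤x = ≤-trans (s≤s z≤n) 2≤x
k+centreCost≤ 1             _   2≤x = 2≤x
k+centreCost≤ (suc (suc k)) k≤x _   = ≤-trans (≤-reflexive (+-identityʳ _)) k≤x

k+centreCost≤′ : ∀ {k x} → k ≡ 0 ⊎ k ≡ 2 → 1 ≤ x → k ≤ x ⊎ 2 ≤ x → k + centreCost k ≤ x
k+centreCost≤′ (inj₁ refl) 1≤x _          = 1≤x
k+centreCost≤′ (inj₂ refl) _   (inj₁ 2≤x) = 2≤x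
k+centreCost≤′ (inj₂ refl) _   (inj₂ 2≤x) = 2≤x

t+idleRound≤ : ∀ k {t J} → t ≤ J → (k ≡ 0 ⊎ k ≡ 2 → suc t ≤ J) → t + idleRound k ≤ J
t+idleRound≤ 0                   {t} _   h = ≤-trans (≤-reflexive (+-comm t 1)) (h (inj₁ refl))
t+idleRound≤ 1                   {t} t≤J _ = ≤-trans (≤-reflexive (+-identityʳ t)) t≤J
t+idleRound≤ 2                   {t} _   h = ≤-trans (≤-reflexive (+-comm t 1)) (h (inj₂ refl))
t+idleRound≤ (suc (suc (suc k))) {t} t≤J _ = ≤-trans (≤-reflexive (+-identityʳ t)) t≤J

another : ∀ {r} → 2 ≤ r → (i : Fin r) → Σ (Fin r) λ j → j ≢ i
another {suc zero}    (s≤s ()) _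
another {suc (suc r)} _        i = punchIn i fzero , punchInᵢ≢i i fzero

module Bounds (r : ℕ) (n : Fin r → ℕ) where
  open Spider r n

  Q K t₂ b₂ : ℕ
  Q  = sum λ i → ⌊ n i /2⌋
  K  = countOdd r n
  t₂ = Q + (K + centreCost K)
  b₂ = t₂ + idleRound K

  t₂≡b₂∸1 : K ≡ 0 ⊎ K ≡ 2 → t₂ ≡ b₂ ∸ 1
  t₂≡b₂∸1 K∈02 = sym (trans (cong (λ x → t₂ + x ∸ 1) (idleRound≡1 K∈02)) (m+n∸n≡m t₂ 1))

  t₂≡b₂ : K ≡ 1 ⊎ 3 ≤ K → t₂ ≡ b₂
  t₂≡b₂ K∈1∪3+ = sym (trans (cong (t₂ +_) (idleRound≡0 K∈1∪3+)) (+-identityʳ t₂))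

  excess : List V → Fin r → ℕ
  excess L i = legCount L i ∸ ⌊ n i /2⌋

  surplus : List V → ℕ
  surplus L = 𝟙 (centre ∈? L) + sum (excess L)

  distinct≡Q+surplus : ∀ {L} → LegsCovered L → distinct L ≡ Q + surplus L
  distinct≡Q+surplus {L} cov = begin
    𝟙 (centre ∈? L) + sum (legCount L)     ≡⟨ cong (𝟙 (centre ∈? L) +_) (∑-∸ λ i → cover-⌊/2⌋ _ (cov i)) ⟨
    𝟙 (centre ∈? L) + (Q + sum (excess L)) ≡⟨ x∙yz≈y∙xz (𝟙 (centre ∈? L)) Q _ ⟩
    Q + surplus L                          ∎
    where open ≡-Reasoning

  t₂≤distinct : ∀ {L} → LegsCovered L → K + centreCost K ≤ surplus L → t₂ ≤ distinct L
  t₂≤distinct cov K+c≤surplus = ≤-trans (+-monoʳ-≤ Q K+c≤surplus) (≤-reflexive (sym (distinct≡Q+surplus cov)))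

  module _ {L : List V} (cov : LegsCovered L) where

    odd≤excess : ∀ i → FirstIn (_∈ L) i ⊎ LeafIn L i → n i % 2 ≤ excess L i
    odd≤excess i end = m+n≤o⇒m≤o∸n (n i % 2) (begin
      n i % 2 + ⌊ n i /2⌋  ≡⟨ +-comm (n i % 2) _ ⟩
      ⌊ n i /2⌋ + n i % 2  ≡⟨ ⌈n/2⌉≡⌊n/2⌋+n%2 (n i) ⟨
      ⌈ n i /2⌉            ≤⟨ cover-⌈/2⌉ _ (cov i) end ⟩
      legCount L i         ∎)
      where open ≤-Reasoning

    1≤excess : ∀ i → FirstIn (_∈ L) i → LeafIn L i → 1 ≤ excess L i
    1≤excess i first last = m+n≤o⇒m≤o∸n 1 (cover-both _ (cov i) first last)

    K≤∑excess : (∀ i → FirstIn (_∈ L) i ⊎ LeafIn L i) → K ≤ sum (excess L)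
    K≤∑excess ends = ≤-trans (≤-reflexive (countOdd≡∑ r n)) (∑-mono-≤ λ i → odd≤excess i (ends i))

    ∑excess≤surplus : sum (excess L) ≤ surplus L
    ∑excess≤surplus = m≤n+m _ _

    surplus-centre : centre ∈ L → surplus L ≡ suc (sum (excess L))
    surplus-centre c∈L = cong (_+ sum (excess L)) (𝟙-yes (centre ∈? L) c∈L)

    2≤∑excess : ∀ {i₁ i₂} → i₁ ≢ i₂ → FirstIn (_∈ L) i₁ → LeafIn L i₁ → FirstIn (_∈ L) i₂ → LeafIn L i₂ →
                2 ≤ sum (excess L)
    2≤∑excess i₁≢i₂ first₁ last₁ first₂ last₂ =
      ≤-trans (+-mono-≤ (1≤excess _ first₁ last₁) (1≤excess _ first₂ last₂)) (pair-≤-∑ (excess L) i₁≢i₂)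

    surplus-all-leaves : (∀ i → LeafIn L i) → CentreSupported L → K + centreCost K ≤ surplus L
    surplus-all-leaves leaves (inj₁ c∈L) = begin
      K + centreCost K       ≤⟨ k+centreCost≤1+k K ⟩
      suc K                  ≤⟨ s≤s (K≤∑excess (inj₂ ∘ leaves)) ⟩
      suc (sum (excess L))   ≡⟨ surplus-centre c∈L ⟨
      surplus L              ∎
      where open ≤-Reasoning
    surplus-all-leaves leaves (inj₂ (i₁ , i₂ , i₁≢i₂ , first₁ , first₂)) =
      ≤-trans (k+centreCost≤ K (K≤∑excess (inj₂ ∘ leaves)) (2≤∑excess i₁≢i₂ first₁ (leaves i₁) first₂ (leaves i₂)))
              ∑excess≤surplus

    module _ (i* : Fin r) (leaves : ∀ i → i ≢ i* → LeafIn L i) where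

      private
        1≤surplus : ∀ i → i ≢ i* → FirstIn (_∈ L) i → 1 ≤ surplus L
        1≤surplus i i≢i* first =
          ≤-trans (1≤excess i first (leaves i i≢i*)) (≤-trans (≤-∑ (excess L) i) ∑excess≤surplus)

        K≤surplus : FirstIn (_∈ L) i* → K ≤ surplus L
        K≤surplus first* = ≤-trans (K≤∑excess end) ∑excess≤surplus
          where
          end : ∀ i → FirstIn (_∈ L) i ⊎ LeafIn L i
          end i with i Fin.≟ i*
          ... | yes refl  = inj₁ first*
          ... | no i≢i*   = inj₂ (leaves i i≢i*)

        K≤1+∑excess : K ≤ suc (sum (excess L))
        K≤1+∑excess = begin
          K                                 ≡⟨ countOdd≡∑ r n ⟩
          sum (λ i → n i % 2)
            ≤⟨ ∑-mono-≤-except i* (λ i i≢i* → odd≤excess i (inj₂ (leaves i i≢i*))) ⟩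
          n i* % 2 + sum (excess L)         ≤⟨ +-monoˡ-≤ _ (n%2≤1 (n i*)) ⟩
          suc (sum (excess L))              ∎
          where open ≤-Reasoning

        surplus-lower : (∀ i → Σ (Fin r) λ j → j ≢ i) → CentreSupported L ⊎ (∀ i → FirstIn (_∈ L) i) →
                        1 ≤ surplus L × (K ≤ surplus L ⊎ 2 ≤ surplus L)
        surplus-lower _ (inj₁ (inj₁ c∈L)) rewrite surplus-centre c∈L = s≤s z≤n , inj₁ K≤1+∑excess
        surplus-lower _ (inj₁ (inj₂ (i₁ , i₂ , i₁≢i₂ , first₁ , first₂))) with i₁ Fin.≟ i* | i₂ Fin.≟ i*
        ... | yes refl | _        = 1≤surplus i₂ (i₁≢i₂ ∘ sym) first₂ , inj₁ (K≤surplus first₁)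
        ... | no i₁≢i* | yes refl = 1≤surplus i₁ i₁≢i* first₁ , inj₁ (K≤surplus first₂)
        ... | no i₁≢i* | no i₂≢i* = 1≤surplus i₁ i₁≢i* first₁ ,
          inj₂ (≤-trans (2≤∑excess i₁≢i₂ first₁ (leaves i₁ i₁≢i*) first₂ (leaves i₂ i₂≢i*)) ∑excess≤surplus)
        surplus-lower another (inj₂ firsts) =
          let j , j≢i* = another i* in 1≤surplus j j≢i* (firsts j) , inj₁ (K≤surplus (firsts i*))

      surplus-refined : (∀ i → Σ (Fin r) λ j → j ≢ i) → CentreSupported L ⊎ (∀ i → FirstIn (_∈ L) i) →
                        K ≡ 0 ⊎ K ≡ 2 → K + centreCost K ≤ surplus L
      surplus-refined another sup K∈02 =
        let 1≤ , K≤⊎2≤ = surplus-lower another sup in k+centreCost≤′ K∈02 1≤ K≤⊎2≤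

  module _ (hn : ∀ i → 1 ≤ n i) (r≥2 : 2 ≤ r) (s : List V) where
    open Burning s

    private
      distinct-take≤ : ∀ j → distinct (take j s) ≤ j ⊓ length s
      distinct-take≤ j = ≤-trans (distinct≤length (take j s)) (≤-reflexive (length-take j s))

      t₂≤placed : ∀ {J} → AllBlue Adj s J → t₂ ≤ distinct (take J s)
      t₂≤placed all = t₂≤distinct cov (surplus-all-leaves cov leaves (centre-blue⇒supported (all centre)))
        where
        cov = allBlue⇒covered λ v → Blue-mono Adj s (n≤1+n _) (all v)
        leaves : ∀ i → LeafIn (take _ s) i
        leaves i p last = last-blue⇒placed last (all (leg i p))

      t₂≤placed-before-last : K ≡ 0 ⊎ K ≡ 2 → ∀ {j} → AllBlue Adj s (suc j) → t₂ ≤ distinct (take j s)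
      t₂≤placed-before-last K∈02 all =
        t₂≤distinct cov (surplus-refined cov i* leaves (another r≥2) (allBlue⇒supported-or-firsts all hn) K∈02)
        where
        cov = allBlue⇒covered all
        some-leaf-missing = allBlue⇒leaves-but-one all (fromℕ< (≤-trans (s≤s z≤n) r≥2))
        i* = proj₁ some-leaf-missing
        leaves = proj₂ some-leaf-missing

    b₂≤round : ∀ {J} → AllBlue Adj s J → b₂ ≤ J
    b₂≤round {zero}  all = ⊥-elim (all centre)
    b₂≤round {suc j} all = t+idleRound≤ K
      (≤-trans (t₂≤placed all) (≤-trans (distinct-take≤ (suc j)) (m⊓n≤m _ _)))
      (λ K∈02 → s≤s (≤-trans (t₂≤placed-before-last K∈02 all) (≤-trans (distinct-take≤ j) (m⊓n≤m _ _))))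

    t₂≤length : ∀ {J} → AllBlue Adj s J → t₂ ≤ length s
    t₂≤length {J} all = ≤-trans (t₂≤placed all) (≤-trans (distinct-take≤ J) (m⊓n≤n _ _))

-- Upper bound

alternating : (m : ℕ) → Bool → List (Fin m)
alternating zero    _     = []
alternating (suc m) true  = fzero ∷ map fsuc (alternating m false)
alternating (suc m) false = map fsuc (alternating m true)

∈-alternating : ∀ {m} b (p : Fin m) → onPhase b (toℕ p) ≡ true → p ∈ alternating m b
∈-alternating true  fzero    _  = here refl
∈-alternating true  (fsuc p) on = there (∈-map⁺ fsuc (∈-alternating false p on))
∈-alternating false (fsuc p) on = ∈-map⁺ fsuc (∈-alternating true p on)

length-alternating : ∀ m → length (alternating m true) ≡ ⌈ m /2⌉ × length (alternating m false) ≡ ⌊ m /2⌋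
length-alternating zero    = refl , refl
length-alternating (suc m) =
  let on , off = length-alternating m in
  cong suc (trans (length-map fsuc (alternating m false)) off) , trans (length-map fsuc (alternating m true)) on

-- How the vertices of a leg are scheduled: a plain leg gets every other vertex, ending at
-- its leaf; a firstPlaced (odd) leg gets the same vertices, its first one placed before
-- all others; a leafLast (odd) leg gets the complementary vertices, its leaf placed last.
data Role : Set where
  plain firstPlaced leafLast : Role

Admissible : Role → ℕ → Set
Admissible R m = R ≡ plain ⊎ m % 2 ≡ 1

phase : Role → ℕ → Bool
phase plain       m = odd m
phase firstPlaced _ = true
phase leafLast    _ = false

firstPart middlePart lastPart : Role → (m : ℕ) → List (Fin m)
firstPart firstPlaced (suc m) = fzero ∷ []
firstPart _           _       = []

middlePart plain       m       = alternating m (odd m)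
middlePart firstPlaced zero    = []
middlePart firstPlaced (suc m) = map fsuc (alternating m false)
middlePart leafLast    m       = alternating m false

lastPart leafLast (suc m) = fromℕ m ∷ []
lastPart _        _       = []

∈-firstPart⇒first : ∀ R {m} {p : Fin m} → p ∈ firstPart R m → toℕ p ≡ 0
∈-firstPart⇒first firstPlaced {suc m} (here refl) = refl

first∈firstPart : ∀ {m} → 1 ≤ m → HasFirst λ p → p ∈ firstPart firstPlaced m
first∈firstPart {suc m} _ = fzero , refl , here refl

last∈lastPart : ∀ {m} → 1 ≤ m → Σ (Fin m) λ p → p ∈ lastPart leafLast m
last∈lastPart {suc m} _ = fromℕ m , here refl

marked⇒early : ∀ R {m} (p : Fin m) → onPhase (phase R m) (toℕ p) ≡ true → p ∈ firstPart R m ⊎ p ∈ middlePart R m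
marked⇒early plain       p        on = inj₂ (∈-alternating _ p on)
marked⇒early firstPlaced fzero    _  = inj₁ (here refl)
marked⇒early firstPlaced (fsuc p) on = inj₂ (∈-map⁺ fsuc (∈-alternating false p on))
marked⇒early leafLast    p        on = inj₂ (∈-alternating false p on)

marked-inner⇒middle : ∀ R {m} (p : Fin m) → 1 ≤ toℕ p → onPhase (phase R m) (toℕ p) ≡ true → p ∈ middlePart R m
marked-inner⇒middle R p 1≤p on with marked⇒early R p on
... | inj₁ p∈first = ⊥-elim (<⇒≢ 1≤p (sym (∈-firstPart⇒first R p∈first)))
... | inj₂ p∈mid   = p∈mid

last-marked : ∀ {m} {p : Fin m} → suc (toℕ p) ≡ m → onPhase (odd m) (toℕ p) ≡ true
last-marked {p = p} last = subst (λ m → onPhase (odd m) (toℕ p) ≡ true) last (onPhase-last (toℕ p))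

last⇒scheduled : ∀ R {m} (p : Fin m) → Admissible R m → suc (toℕ p) ≡ m →
                 p ∈ firstPart R m ⊎ p ∈ middlePart R m ⊎ p ∈ lastPart R m
last⇒scheduled plain p _ last = inj₂ (inj₁ (∈-alternating _ p (last-marked last)))
last⇒scheduled firstPlaced {m} p (inj₂ m%2≡1) last = Sum.map₂ inj₁ (marked⇒early firstPlaced p marked)
  where marked = subst (λ b → onPhase b (toℕ p) ≡ true) (%2≡1⇒odd m m%2≡1) (last-marked last)
last⇒scheduled leafLast {suc m} p _ last =
  inj₂ (inj₂ (here (toℕ-injective (trans (suc-injective last) (sym (toℕ-fromℕ m))))))

length-parts : ∀ R {m} → 1 ≤ m → Admissible R m →
               length (firstPart R m) + length (middlePart R m) + length (lastPart R m) ≡ ⌈ m /2⌉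
length-parts plain {m} _ _ with odd m in odd≡
... | true  = trans (+-identityʳ _) (proj₁ (length-alternating m))
... | false = trans (+-identityʳ _) (trans (proj₂ (length-alternating m)) (even⇒⌊/2⌋≡⌈/2⌉ m odd≡))
length-parts firstPlaced {suc m} _ _ =
  cong suc (trans (+-identityʳ _) (trans (length-map fsuc (alternating m false)) (proj₂ (length-alternating m))))
length-parts leafLast {suc m} _ (inj₂ m%2≡1) = begin
  length (alternating (suc m) false) + 1  ≡⟨ cong (_+ 1) (proj₂ (length-alternating (suc m))) ⟩
  ⌊ suc m /2⌋ + 1                         ≡⟨ cong (⌊ suc m /2⌋ +_) m%2≡1 ⟨
  ⌊ suc m /2⌋ + suc m % 2                 ≡⟨ ⌈n/2⌉≡⌊n/2⌋+n%2 (suc m) ⟨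
  ⌈ suc m /2⌉                             ∎
  where open ≡-Reasoning

0-1-2-or-≥3 : ∀ k → k ≡ 0 ⊎ k ≡ 1 ⊎ k ≡ 2 ⊎ 3 ≤ k
0-1-2-or-≥3 0                   = inj₁ refl
0-1-2-or-≥3 1                   = inj₂ (inj₁ refl)
0-1-2-or-≥3 2                   = inj₂ (inj₂ (inj₁ refl))
0-1-2-or-≥3 (suc (suc (suc k))) = inj₂ (inj₂ (inj₂ (s≤s (s≤s (s≤s z≤n)))))

module Schedules (r : ℕ) (n : Fin r → ℕ) (hn : ∀ i → 1 ≤ n i) where
  open Spider r n
  open Bounds r n using (Q; K; t₂; b₂)

  module _ (s : List V) (M : ℕ) (ph : Fin r → Bool)
           (marked-blue : ∀ i (p : Fin (n i)) → onPhase (ph i) (toℕ p) ≡ true → Blue Adj s M (leg i p))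
           (centre-blue : ∀ i (p : Fin (n i)) → 1 ≤ toℕ p → onPhase (ph i) (toℕ p) ≡ true →
                          Blue Adj s M centre) where

    inner-blue : ∀ i p → suc (toℕ p) < n i → Blue Adj s (suc M) (leg i p)
    inner-blue i p inner with onPhase (ph i) (toℕ p) in on
    ... | true  = inj₁ (marked-blue i p on)
    ... | false = inj₂ (inj₂ (spread-of-neighbours (prev (toℕ p) refl) next))
      where
      p⁺ = fromℕ< inner
      p⁺≡1+p = toℕ-fromℕ< inner
      on⁺ : onPhase (ph i) (toℕ p⁺) ≡ true
      on⁺ = trans (cong (onPhase (ph i)) p⁺≡1+p) (onPhase-next {ph i} {toℕ p} on)

      next : NextIn (Blue Adj s M) i p
      next = p⁺ , p⁺≡1+p , marked-blue i p⁺ on⁺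

      prev : ∀ k → toℕ p ≡ k → PrevIn (Blue Adj s M) i p
      prev zero    p≡0   = inj₁ (p≡0 , centre-blue i p⁺ (≤-reflexive (sym (trans p⁺≡1+p (cong suc p≡0)))) on⁺)
      prev (suc k) p≡1+k = inj₂ (p⁻ , trans p≡1+k (cong suc (sym p⁻≡k)) , marked-blue i p⁻ on⁻)
        where
        k<n : k < n i
        k<n = ≤-trans (n≤1+n _) (subst (_< n i) p≡1+k (Fin.toℕ<n p))
        p⁻ = fromℕ< k<n
        p⁻≡k = toℕ-fromℕ< k<n
        on⁻ : onPhase (ph i) (toℕ p⁻) ≡ true
        on⁻ = trans (cong (onPhase (ph i)) p⁻≡k)
                    (onPhase-prev {ph i} {k} (trans (cong (onPhase (ph i)) (sym p≡1+k)) on))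

  module Schedule (ρ : Fin r → Role) (adm : ∀ i → Admissible (ρ i) (n i)) (extra : List V) where

    part : (Role → (m : ℕ) → List (Fin m)) → List V
    part P = concatFin λ i → map (leg i) (P (ρ i) (n i))

    firsts mids lasts s : List V
    firsts = part firstPart
    mids   = part middlePart
    lasts  = part lastPart
    s      = extra ++ firsts ++ mids ++ lasts

    F M : ℕ
    F = length extra + length firsts
    M = length extra + (length firsts + length mids)

    ∈-part : ∀ P i {p} → p ∈ P (ρ i) (n i) → leg i p ∈ part P
    ∈-part P i p∈ = ∈-concatFin _ i (∈-map⁺ (leg i) p∈)

    firsts-placed : ∀ {v} → v ∈ firsts → v ∈ take F s
    firsts-placed v∈ = ∈-take-++ extra (∈-take-length firsts v∈)

    mids-placed : ∀ {v} → v ∈ mids → v ∈ take M s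
    mids-placed v∈ = ∈-take-++ extra (∈-take-++ firsts (∈-take-length mids v∈))

    all-placed : ∀ {v} → v ∈ s → v ∈ take (length s) s
    all-placed {v} = subst (v ∈_) (sym (take-all (length s) s ≤-refl))

    F≤M : F ≤ M
    F≤M = ≤-trans (m≤m+n F (length mids)) (≤-reflexive (+-assoc (length extra) _ _))

    F<M : 1 ≤ length mids → F < M
    F<M 1≤mids = begin
      suc F                           ≡⟨ +-comm 1 F ⟩
      F + 1                           ≤⟨ +-monoʳ-≤ F 1≤mids ⟩
      F + length mids                 ≡⟨ +-assoc (length extra) _ _ ⟩
      M                               ∎
      where open ≤-Reasoning

    length-s-parts : length s ≡ length extra + (length firsts + (length mids + length lasts))
    length-s-parts = trans (length-++ extra)
      (cong (length extra +_) (trans (length-++ firsts) (cong (length firsts +_) (length-++ mids))))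

    M+lasts≡length : M + length lasts ≡ length s
    M+lasts≡length = begin
      length extra + (length firsts + length mids) + length lasts
        ≡⟨ +-assoc (length extra) _ _ ⟩
      length extra + (length firsts + length mids + length lasts)
        ≡⟨ cong (length extra +_) (+-assoc (length firsts) _ _) ⟩
      length extra + (length firsts + (length mids + length lasts))
        ≡⟨ length-s-parts ⟨
      length s ∎
      where open ≡-Reasoning

    length-parts-sum : length firsts + (length mids + length lasts) ≡ Q + K
    length-parts-sum = begin
      length firsts + (length mids + length lasts)
        ≡⟨ cong₂ _+_ (len firstPart) (cong₂ _+_ (len middlePart) (len lastPart)) ⟩
      sum ℓf + (sum ℓm + sum ℓl)                          ≡⟨ +-assoc (sum ℓf) _ _ ⟨
      sum ℓf + sum ℓm + sum ℓl                            ≡⟨ cong (_+ sum ℓl) (∑-distrib-+ ℓf ℓm) ⟨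
      sum (λ i → ℓf i + ℓm i) + sum ℓl                    ≡⟨ ∑-distrib-+ (λ i → ℓf i + ℓm i) ℓl ⟨
      sum (λ i → ℓf i + ℓm i + ℓl i)                      ≡⟨ sum-cong-≗ (λ i → length-parts (ρ i) (hn i) (adm i)) ⟩
      sum (λ i → ⌈ n i /2⌉)                               ≡⟨ sum-cong-≗ (λ i → ⌈n/2⌉≡⌊n/2⌋+n%2 (n i)) ⟩
      sum (λ i → ⌊ n i /2⌋ + n i % 2)                     ≡⟨ ∑-distrib-+ (λ i → ⌊ n i /2⌋) (λ i → n i % 2) ⟩
      Q + sum (λ i → n i % 2)                             ≡⟨ cong (Q +_) (countOdd≡∑ r n) ⟨
      Q + K                                               ∎
      where
      open ≡-Reasoning
      ℓf ℓm ℓl : Fin r → ℕ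
      ℓf i = length (firstPart (ρ i) (n i))
      ℓm i = length (middlePart (ρ i) (n i))
      ℓl i = length (lastPart (ρ i) (n i))
      len : ∀ P → length (part P) ≡ sum λ i → length (P (ρ i) (n i))
      len P = trans (length-concatFin (λ i → map (leg i) (P (ρ i) (n i))))
                    (sum-cong-≗ λ i → length-map (leg {r} {n} i) (P (ρ i) (n i)))

    length-s : length s ≡ length extra + (Q + K)
    length-s = trans length-s-parts (cong (length extra +_) length-parts-sum)

    TwoFirstPlacedLegs : Set
    TwoFirstPlacedLegs = Σ (Fin r) λ a → Σ (Fin r) λ b → a ≢ b × ρ a ≡ firstPlaced × ρ b ≡ firstPlaced

    centre-blue-after-firsts : centre ∈ extra ⊎ TwoFirstPlacedLegs → Blue Adj s (suc F) centre
    centre-blue-after-firsts (inj₁ c∈extra) =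
      inj₁ (placed⇒Blue Adj s (take-mono s (m≤m+n _ _) (∈-take-length extra c∈extra)))
    centre-blue-after-firsts (inj₂ (a , b , a≢b , ρa , ρb)) =
      inj₂ (inj₂ (spread-of-firsts (a , b , a≢b , first-blue a ρa , first-blue b ρb)))
      where
      first-blue : ∀ i → ρ i ≡ firstPlaced → FirstIn (Blue Adj s F) i
      first-blue i ρi with first∈firstPart (hn i)
      ... | p , p≡0 , p∈ = p , p≡0 , placed⇒Blue Adj s (firsts-placed (∈-part firstPart i p∈′))
        where p∈′ = subst (λ R → p ∈ firstPart R (n i)) (sym ρi) p∈

    module _ (early : centre ∈ extra ⊎ TwoFirstPlacedLegs) where

      marked-blue : ∀ i p → onPhase (phase (ρ i) (n i)) (toℕ p) ≡ true → Blue Adj s M (leg i p)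
      marked-blue i p on with marked⇒early (ρ i) p on
      ... | inj₁ p∈first = Blue-mono Adj s F≤M (placed⇒Blue Adj s (firsts-placed (∈-part firstPart i p∈first)))
      ... | inj₂ p∈mid   = placed⇒Blue Adj s (mids-placed (∈-part middlePart i p∈mid))

      centre-blue : ∀ i p → 1 ≤ toℕ p → onPhase (phase (ρ i) (n i)) (toℕ p) ≡ true → Blue Adj s M centre
      centre-blue i p 1≤p on = Blue-mono Adj s (F<M (∈⇒1≤length leg∈mids)) (centre-blue-after-firsts early)
        where leg∈mids = ∈-part middlePart i (marked-inner⇒middle (ρ i) p 1≤p on)

      leaf-scheduled : ∀ i p → suc (toℕ p) ≡ n i → leg i p ∈ s
      leaf-scheduled i p last with last⇒scheduled (ρ i) p (adm i) last
      ... | inj₁ p∈first        = ∈-++⁺ʳ extra (∈-++⁺ˡ (∈-part firstPart i p∈first))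
      ... | inj₂ (inj₁ p∈mid)   = ∈-++⁺ʳ extra (∈-++⁺ʳ firsts (∈-++⁺ˡ (∈-part middlePart i p∈mid)))
      ... | inj₂ (inj₂ p∈last)  = ∈-++⁺ʳ extra (∈-++⁺ʳ firsts (∈-++⁺ʳ mids (∈-part lastPart i p∈last)))

      all-blue : ∀ {T} → suc M ≤ T → length s ≤ T → AllBlue Adj s T
      all-blue M<T _ centre = Blue-mono Adj s (≤-trans (s≤s F≤M) M<T) (centre-blue-after-firsts early)
      all-blue M<T s≤T (leg i p) with suc (toℕ p) ℕ.≟ n i
      ... | yes last = Blue-mono Adj s s≤T (placed⇒Blue Adj s (all-placed (leaf-scheduled i p last)))
      ... | no ¬last = Blue-mono Adj s M<T
        (inner-blue s M (λ i → phase (ρ i) (n i)) marked-blue centre-blue i p (≤∧≢⇒< (Fin.toℕ<n p) ¬last))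

      optimal : length extra ≡ centreCost K → 1 ≤ length lasts ⊎ 1 ≤ idleRound K →
                AllBlue Adj s b₂ × length s ≡ t₂
      optimal extra≡ lasts⊎idle =
        all-blue (M<b₂ lasts⊎idle) (≤-trans (≤-reflexive length≡t₂) (m≤m+n t₂ _)) , length≡t₂
        where
        open ≤-Reasoning
        length≡t₂ : length s ≡ t₂
        length≡t₂ = begin-equality
          length s                   ≡⟨ length-s ⟩
          length extra + (Q + K)     ≡⟨ cong (_+ (Q + K)) extra≡ ⟩
          centreCost K + (Q + K)     ≡⟨ x∙yz≈y∙xz (centreCost K) Q K ⟩
          Q + (centreCost K + K)     ≡⟨ cong (Q +_) (+-comm (centreCost K) K) ⟩
          t₂                         ∎
        M+lasts≡t₂ = trans M+lasts≡length length≡t₂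
        M<b₂ : 1 ≤ length lasts ⊎ 1 ≤ idleRound K → suc M ≤ b₂
        M<b₂ (inj₁ 1≤lasts) = begin
          suc M                   ≡⟨ +-comm 1 M ⟩
          M + 1                   ≤⟨ +-monoʳ-≤ M 1≤lasts ⟩
          M + length lasts        ≡⟨ M+lasts≡t₂ ⟩
          t₂                      ≤⟨ m≤m+n t₂ _ ⟩
          b₂                      ∎
        M<b₂ (inj₂ 1≤idle) = begin
          suc M                   ≤⟨ s≤s (m≤m+n M _) ⟩
          suc (M + length lasts)  ≡⟨ cong suc M+lasts≡t₂ ⟩
          suc t₂                  ≡⟨ +-comm 1 t₂ ⟩
          t₂ + 1                  ≤⟨ +-monoʳ-≤ t₂ 1≤idle ⟩
          b₂                      ∎

  assign : (Fin r → Role) → Fin r → Role → Fin r → Role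
  assign ρ a R = updateAt ρ a λ _ → R

  assign-admissible : ∀ {ρ a} R → (∀ i → Admissible (ρ i) (n i)) → n a % 2 ≡ 1 →
                      ∀ i → Admissible (assign ρ a R i) (n i)
  assign-admissible {ρ} {a} R adm odd-a i with i Fin.≟ a
  ... | yes refl = inj₂ odd-a
  ... | no i≢a   = subst (λ R′ → Admissible R′ (n i)) (sym (updateAt-minimal i a ρ i≢a)) (adm i)

  plain-admissible : ∀ i → Admissible plain (n i)
  plain-admissible _ = inj₁ refl

  OptimalSchedule : Set
  OptimalSchedule = Σ (List V) λ s → AllBlue Adj s b₂ × length s ≡ t₂

  K≡#odd : K ≡ count λ i → n i % 2 ℕ.≟ 1
  K≡#odd = trans (countOdd≡∑ r n) (sum-cong-≗ λ i → %2≡𝟙 (n i))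

  lasts-nonempty : ∀ ρ (adm : ∀ i → Admissible (ρ i) (n i)) extra c → ρ c ≡ leafLast →
                   1 ≤ length (Schedule.lasts ρ adm extra)
  lasts-nonempty ρ adm extra c ρc with last∈lastPart (hn c)
  ... | p , p∈ = ∈⇒1≤length (Schedule.∈-part ρ adm extra lastPart c p∈′)
    where p∈′ = subst (λ R → p ∈ lastPart R (n c)) (sym ρc) p∈

  schedule-K≡0 : K ≡ 0 → OptimalSchedule
  schedule-K≡0 K≡0 =
    s , optimal (inj₁ (here refl)) (cong centreCost (sym K≡0)) (inj₂ (≤-reflexive (cong idleRound (sym K≡0))))
    where open Schedule (λ _ → plain) plain-admissible (centre ∷ [])

  schedule-K≡1 : K ≡ 1 → OptimalSchedule
  schedule-K≡1 K≡1 with pick₁ (λ i → n i % 2 ℕ.≟ 1) (≤-reflexive (trans (sym K≡1) K≡#odd))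
  ... | a , odd-a =
    s , optimal (inj₁ (here refl)) (cong centreCost (sym K≡1)) (inj₁ (lasts-nonempty ρ adm (centre ∷ []) a ρa))
    where
    ρ = assign (λ _ → plain) a leafLast
    adm = assign-admissible leafLast plain-admissible odd-a
    ρa : ρ a ≡ leafLast
    ρa = updateAt-updates a _
    open Schedule ρ adm (centre ∷ [])

  schedule-K≡2 : K ≡ 2 → OptimalSchedule
  schedule-K≡2 K≡2 with pick₂ (λ i → n i % 2 ℕ.≟ 1) (≤-reflexive (trans (sym K≡2) K≡#odd))
  ... | a , b , a≢b , odd-a , odd-b =
    s , optimal (inj₂ (a , b , a≢b , ρa , ρb)) (cong centreCost (sym K≡2))
                (inj₂ (≤-reflexive (cong idleRound (sym K≡2))))
    where
    ρ = assign (assign (λ _ → plain) b firstPlaced) a firstPlaced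
    adm = assign-admissible firstPlaced (assign-admissible firstPlaced plain-admissible odd-b) odd-a
    ρa : ρ a ≡ firstPlaced
    ρa = updateAt-updates a _
    ρb : ρ b ≡ firstPlaced
    ρb = trans (updateAt-minimal b a _ (a≢b ∘ sym)) (updateAt-updates b _)
    open Schedule ρ adm []

  schedule-K≥3 : 3 ≤ K → OptimalSchedule
  schedule-K≥3 3≤K with pick₃ (λ i → n i % 2 ℕ.≟ 1) (≤-trans 3≤K (≤-reflexive K≡#odd))
  ... | a , b , c , a≢b , a≢c , b≢c , odd-a , odd-b , odd-c =
    s , optimal (inj₂ (a , b , a≢b , ρa , ρb)) (cong centreCost (m+[n∸m]≡n 3≤K))
                (inj₁ (lasts-nonempty ρ adm [] c ρc))
    where
    ρ = assign (assign (assign (λ _ → plain) c leafLast) b firstPlaced) a firstPlaced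
    adm = assign-admissible firstPlaced
            (assign-admissible firstPlaced (assign-admissible leafLast plain-admissible odd-c) odd-b) odd-a
    ρa : ρ a ≡ firstPlaced
    ρa = updateAt-updates a _
    ρb : ρ b ≡ firstPlaced
    ρb = trans (updateAt-minimal b a _ (a≢b ∘ sym)) (updateAt-updates b _)
    ρc : ρ c ≡ leafLast
    ρc = trans (updateAt-minimal c a _ (a≢c ∘ sym))
               (trans (updateAt-minimal c b _ (b≢c ∘ sym)) (updateAt-updates c _))
    open Schedule ρ adm []

  optimal-schedule : OptimalSchedule
  optimal-schedule with 0-1-2-or-≥3 K
  ... | inj₁ K≡0               = schedule-K≡0 K≡0
  ... | inj₂ (inj₁ K≡1)        = schedule-K≡1 K≡1
  ... | inj₂ (inj₂ (inj₁ K≡2)) = schedule-K≡2 K≡2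
  ... | inj₂ (inj₂ (inj₂ 3≤K)) = schedule-K≥3 3≤K

corollary1 : (r : ℕ) → 3 ≤ r → (n : Fin r → ℕ) → ((i : Fin r) → 1 ≤ n i) →
    Σ ℕ (λ b → Σ ℕ (λ t →
      IsB2 (SpiderAdj r n) b × IsT2 (SpiderAdj r n) b t
      × ((countOdd r n ≡ 0 ⊎ countOdd r n ≡ 2) → t ≡ b ∸ 1)
      × ((countOdd r n ≡ 1 ⊎ 3 ≤ countOdd r n) → t ≡ b)))
corollary1 r 3≤r n hn =
  b₂ , t₂ , ((s , optimal) , λ s′ _ rd → b₂≤round hn 2≤r s′ (proj₁ rd))
          , ((s , optimal , length≡t₂) , λ s′ opt → t₂≤length hn 2≤r s′ (proj₁ opt))
          , t₂≡b₂∸1 , t₂≡b₂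
  where
  open Bounds r n
  open Schedules r n hn using (optimal-schedule)

  2≤r : 2 ≤ r
  2≤r = ≤-trans (n≤1+n 2) 3≤r

  s = proj₁ optimal-schedule
  length≡t₂ = proj₂ (proj₂ optimal-schedule)

  optimal : IsRd (SpiderAdj r n) s b₂
  optimal = proj₁ (proj₂ optimal-schedule) , λ _ → b₂≤round hn 2≤r s
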